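{- Let $n$ and $t$ be positive integers such that $t$ divides $n$. There exists a perfect matching $F$ of $K_{2n}$ such that $\ell(F)=\left\{1^t,2^t,\ldots,\left(\frac{n}{t}\right)^t\right\}$ (each integer from $1$ to $\frac{n}{t}$ appearing exactly $t$ times) if and only if either $t$ is even or $\frac{n}{t}\equiv 0,1\pmod 4$.
   Context: For a positive integer $v$, $K_v$ denotes the complete graph on the vertex set $\{0,1,\ldots,v-1\}$. The length of an edge $\{u,w\}$ of $K_v$ is $\ell(u,w)=\min(|u-w|,\,v-|u-w|)$. For a subgraph $\Gamma$ of $K_v$, $\ell(\Gamma)$ is the list (multiset) of lengths of all edges of $\Gamma$, counted with multiplicity. A perfect matching of $K_{2n}$ is a set of $n$ pairwise disjoint edges covering all vertices. -}

module Defs where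

open import Data.Nat using (ℕ; zero; suc; _+_; _*_; _∸_; _<_; _≤ᵇ_)
open import Data.Nat.Base using (_⊔_; _⊓_)
open import Data.Bool using (if_then_else_)
open import Data.Product using (_×_; _,_)
open import Data.List using (List; []; _∷_; map; concatMap; replicate; upTo; applyUpTo)
open import Data.List.Relation.Unary.All using (All)
open import Data.List.Relation.Binary.Permutation.Propositional using (_↭_)
open import Relation.Binary.PropositionalEquality using (_≢_)

-- an edge of K_v is an (unordered) pair, represented by an ordered pair of vertices
Edge : Set
Edge = ℕ × ℕ

absDiff : ℕ → ℕ → ℕ
absDiff u w = (u ∸ w) + (w ∸ u)

edgeLength : ℕ → Edge → ℕ
edgeLength v (u , w) = absDiff u w ⊓ (v ∸ absDiff u w)

lengths : ℕ → List Edge → List ℕ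
lengths v F = map (edgeLength v) F

endpoints : List Edge → List ℕ
endpoints [] = []
endpoints ((u , w) ∷ F) = u ∷ w ∷ endpoints F

IsEdgeOf : ℕ → Edge → Set
IsEdgeOf v (u , w) = (u < v) × (w < v) × (u ≢ w)

-- F is a perfect matching of K_{2n}: a list of edges of K_{2n} which are
-- pairwise disjoint and cover every vertex, i.e. every vertex 0..2n-1 occurs
-- exactly once among the endpoints.
IsPerfectMatching : ℕ → List Edge → Set
IsPerfectMatching n F = All (IsEdgeOf (2 * n)) F × (endpoints F ↭ upTo (2 * n))

repeatedRange : ℕ → ℕ → List ℕ
repeatedRange t m = concatMap (replicate t) (applyUpTo suc m)

module Submission where

-- Necessity is a parity count.  An edge {u, w} of K_2n has length congruent to u + w
-- modulo 2, so over a perfect matching the total length t(1 + ... + m), m = n / t, has the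
-- parity of 0 + 1 + ... + (2n - 1), i.e. of n = tm.  For odd t this makes m(m + 3)/2 even,
-- which means m ≡ 0, 1 (mod 4).
--
-- Sufficiency: lengths at most m ≤ n are plain differences |u - w|, so it suffices to pair
-- up 0, ..., 2n - 1 using every difference 1, ..., m exactly t times (a t-fold Skolem
-- system).  Such systems concatenate, so we only need a twofold system for every m and a
-- Skolem sequence for m ≡ 0, 1 (mod 4).  Both are assembled from blocks of nested pairs,
-- whose differences form arithmetic progressions of step 2, and a few single vertices
-- (holes) that are paired up at the end.

open import Defs
open import Data.Nat using (ℕ; zero; suc; _+_; _*_; _∸_; _⊓_; _≤_; _<_; _%_; _/_; NonZero; s≤s; z≤n)
open import Data.Nat.Properties
open import Data.Nat.Divisibility using (_∣_; divides; ∣m+n∣m⇒∣n; ∣m∣n⇒∣m+n; ∣1⇒≡1)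
open import Data.Nat.DivMod using (m≡m%n+[m/n]*n; m%n<n; m*n/n≡m)
open import Data.Nat.Primality using (euclidsLemma; prime[2])
open import Data.Nat.ListAction using (sum)
open import Data.Nat.ListAction.Properties using (sum-++; sum-↭)
open import Data.Nat.Tactic.RingSolver using (solve)
open import Data.Product using (Σ; _×_; _,_; proj₁; proj₂)
open import Data.Sum using (_⊎_; inj₁; inj₂; map₂)
open import Data.Empty using (⊥-elim)
open import Function using (_∘_)
open import Function.Bundles using (_⇔_; mk⇔)
open import Data.List using (List; []; _∷_; _++_; [_]; map; applyUpTo; upTo; replicate; concatMap)
open import Data.List.Properties using (map-++; ++-identityʳ; concatMap-pure; map-cong-local; upTo-∷ʳ)
open import Data.List.Relation.Unary.All as All using (All)
open import Data.List.Relation.Unary.All.Properties using (applyUpTo⁺₁; replicate⁺; concat⁺; map⁺; map⁻)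
open import Data.List.Relation.Binary.Permutation.Propositional
  using (_↭_; ↭-refl; ↭-sym; ↭-trans; ↭-reflexive; ↭-prep; ↭-swap; module PermutationReasoning)
open import Data.List.Relation.Binary.Permutation.Propositional.Properties
  using (++⁺; ++⁺ˡ; ++-comm; shift; All-resp-↭; ++-commutativeMonoid)
open import Algebra.Solver.CommutativeMonoid (++-commutativeMonoid {A = ℕ})
  using (_⊜_; _⊕_; id) renaming (solve to solve-↭)
open import Relation.Nullary using (¬_)
open import Relation.Binary.PropositionalEquality hiding ([_])

absDiff-+ : ∀ u d → absDiff u (u + d) ≡ d
absDiff-+ u d = cong₂ _+_ (m≤n⇒m∸n≡0 (m≤m+n u d)) (m+n∸m≡n u d)

gap : Edge → ℕ
gap (u , w) = absDiff u w

interval : ℕ → ℕ → List ℕ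
interval a zero = []
interval a (suc L) = a ∷ interval (suc a) L

interval-++ : ∀ a L L' → interval a (L + L') ≡ interval a L ++ interval (a + L) L'
interval-++ a zero L' = cong (λ b → interval b L') (sym (+-identityʳ a))
interval-++ a (suc L) L' = cong (a ∷_) (trans (interval-++ (suc a) L L')
  (cong (λ b → interval (suc a) L ++ interval b L') (sym (+-suc a L))))

applyUpTo-interval : ∀ (f : ℕ → ℕ) a L → (∀ i → f i ≡ a + i) → applyUpTo f L ≡ interval a L
applyUpTo-interval f a zero f≗ = refl
applyUpTo-interval f a (suc L) f≗ = cong₂ _∷_ (trans (f≗ 0) (+-identityʳ a))
  (applyUpTo-interval (λ i → f (suc i)) (suc a) L (λ i → trans (f≗ (suc i)) (+-suc a i)))

endpoints-++ : ∀ F G → endpoints (F ++ G) ≡ endpoints F ++ endpoints G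
endpoints-++ [] G = refl
endpoints-++ ((u , w) ∷ F) G = cong (λ E → u ∷ w ∷ E) (endpoints-++ F G)

replicate-+ : ∀ c c' (x : ℕ) → replicate (c + c') x ≡ replicate c x ++ replicate c' x
replicate-+ zero c' x = refl
replicate-+ (suc c) c' x = cong (x ∷_) (replicate-+ c c' x)

concatMap-replicate-+ : ∀ c c' xs →
  concatMap (replicate (c + c')) xs ↭ concatMap (replicate c) xs ++ concatMap (replicate c') xs
concatMap-replicate-+ c c' [] = ↭-refl
concatMap-replicate-+ c c' (x ∷ xs) = begin
  replicate (c + c') x ++ concatMap (replicate (c + c')) xs
    ≡⟨ cong (_++ concatMap (replicate (c + c')) xs) (replicate-+ c c' x) ⟩
  (replicate c x ++ replicate c' x) ++ concatMap (replicate (c + c')) xs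
    ↭⟨ ++⁺ˡ (replicate c x ++ replicate c' x) (concatMap-replicate-+ c c' xs) ⟩
  (replicate c x ++ replicate c' x) ++ concatMap (replicate c) xs ++ concatMap (replicate c') xs
    ↭⟨ solve-↭ 4 (λ r r' s s' → (r ⊕ r') ⊕ (s ⊕ s') ⊜ (r ⊕ s) ⊕ (r' ⊕ s')) ↭-refl
         (replicate c x) (replicate c' x) (concatMap (replicate c) xs) (concatMap (replicate c') xs) ⟩
  (replicate c x ++ concatMap (replicate c) xs) ++ replicate c' x ++ concatMap (replicate c') xs ∎
  where open PermutationReasoning

repeatedRange-+ : ∀ c c' m → repeatedRange (c + c') m ↭ repeatedRange c m ++ repeatedRange c' m
repeatedRange-+ c c' m = concatMap-replicate-+ c c' (applyUpTo suc m)

repeatedRange-0 : ∀ m → repeatedRange 0 m ≡ []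
repeatedRange-0 m = concatMap-replicate-0 (applyUpTo suc m)
  where
  concatMap-replicate-0 : ∀ (xs : List ℕ) → concatMap (replicate 0) xs ≡ []
  concatMap-replicate-0 [] = refl
  concatMap-replicate-0 (x ∷ xs) = concatMap-replicate-0 xs

repeatedRange-1 : ∀ m → repeatedRange 1 m ≡ interval 1 m
repeatedRange-1 m = trans (concatMap-pure (applyUpTo suc m)) (applyUpTo-interval suc 1 m (λ _ → refl))

repeatedRange-2 : ∀ m → repeatedRange 2 m ↭ interval 1 m ++ interval 1 m
repeatedRange-2 m =
  ↭-trans (repeatedRange-+ 1 1 m) (↭-reflexive (cong₂ _++_ (repeatedRange-1 m) (repeatedRange-1 m)))

triangular : ℕ → ℕ
triangular m = sum (applyUpTo suc m)

sum-repeatedRange : ∀ t m → sum (repeatedRange t m) ≡ t * triangular m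
sum-repeatedRange zero m = cong sum (repeatedRange-0 m)
sum-repeatedRange (suc t) m = begin
  sum (repeatedRange (1 + t) m)                  ≡⟨ sum-↭ (repeatedRange-+ 1 t m) ⟩
  sum (repeatedRange 1 m ++ repeatedRange t m)   ≡⟨ sum-++ (repeatedRange 1 m) (repeatedRange t m) ⟩
  sum (repeatedRange 1 m) + sum (repeatedRange t m)
    ≡⟨ cong₂ _+_ (cong sum (concatMap-pure (applyUpTo suc m))) (sum-repeatedRange t m) ⟩
  triangular m + t * triangular m                ∎
  where open ≡-Reasoning

repeatedRange-bounds : ∀ t m → All (λ d → 1 ≤ d × d ≤ m) (repeatedRange t m)
repeatedRange-bounds t m =
  concat⁺ (map⁺ (All.map (replicate⁺ t) (applyUpTo⁺₁ suc m (λ i<m → s≤s z≤n , i<m))))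

-- Necessity

edgeLength-comm : ∀ N u w → edgeLength N (u , w) ≡ edgeLength N (w , u)
edgeLength-comm N u w = cong (λ δ → δ ⊓ (N ∸ δ)) (+-comm (u ∸ w) (w ∸ u))

-- Both |u - w| and N - |u - w| have the parity of u + w when N is even.
edgeLength-parity-≤ : ∀ {N} → 2 ∣ N → ∀ {u w} → u ≤ w → w ≤ N →
                      2 ∣ edgeLength N (u , w) + (u + w)
edgeLength-parity-≤ {N} 2∣N {u} u≤w w≤N with m≤n⇒∃[o]m+o≡n u≤w
... | d , refl rewrite absDiff-+ u d with ⊓-sel d (N ∸ d)
...   | inj₁ eq rewrite eq = divides (u + d) (solve (u ∷ d ∷ []))
...   | inj₂ eq rewrite eq = subst (2 ∣_) (sym shape) (∣m∣n⇒∣m+n 2∣N (divides u (*-comm 2 u)))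
  where
  rearrange : ∀ x → x + (u + (u + d)) ≡ (x + d) + 2 * u
  rearrange x = solve (x ∷ u ∷ d ∷ [])
  shape : (N ∸ d) + (u + (u + d)) ≡ N + 2 * u
  shape = trans (rearrange (N ∸ d)) (cong (_+ 2 * u) (m∸n+n≡m (m+n≤o⇒n≤o u w≤N)))

edgeLength-parity : ∀ {N} → 2 ∣ N → ∀ {u w} → u ≤ N → w ≤ N →
                    2 ∣ edgeLength N (u , w) + (u + w)
edgeLength-parity {N} 2∣N {u} {w} u≤N w≤N with ≤-total u w
... | inj₁ u≤w = edgeLength-parity-≤ 2∣N u≤w w≤N
... | inj₂ w≤u = subst₂ (λ ℓ s → 2 ∣ ℓ + s) (edgeLength-comm N w u) (+-comm w u)
                   (edgeLength-parity-≤ 2∣N w≤u u≤N)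

lengths+endpoints-even : ∀ {N} → 2 ∣ N → ∀ {F} → All (IsEdgeOf N) F →
                         2 ∣ sum (lengths N F) + sum (endpoints F)
lengths+endpoints-even 2∣N All.[] = divides 0 refl
lengths+endpoints-even {N} 2∣N {(u , w) ∷ F} ((u<N , w<N , _) All.∷ edges) =
  subst (2 ∣_) (regroup (edgeLength N (u , w)) (sum (lengths N F)) (sum (endpoints F)))
    (∣m∣n⇒∣m+n (edgeLength-parity 2∣N (<⇒≤ u<N) (<⇒≤ w<N)) (lengths+endpoints-even 2∣N edges))
  where
  regroup : ∀ ℓ L E → (ℓ + (u + w)) + (L + E) ≡ (ℓ + L) + (u + (w + E))
  regroup ℓ L E = solve (ℓ ∷ L ∷ E ∷ u ∷ w ∷ [])

sum-upTo : ∀ n → 2 * sum (upTo n) + n ≡ n * n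
sum-upTo zero = refl
sum-upTo (suc n) = begin
  2 * sum (upTo (suc n)) + suc n       ≡⟨ cong (λ xs → 2 * sum xs + suc n) (sym (upTo-∷ʳ n)) ⟩
  2 * sum (upTo n ++ [ n ]) + suc n    ≡⟨ cong (λ s → 2 * s + suc n) (sum-++ (upTo n) [ n ]) ⟩
  2 * (sum (upTo n) + (n + 0)) + suc n ≡⟨ step (sum (upTo n)) ⟩
  (2 * sum (upTo n) + n) + (2 * n + 1) ≡⟨ cong (_+ (2 * n + 1)) (sum-upTo n) ⟩
  n * n + (2 * n + 1)                  ≡⟨ solve (n ∷ []) ⟩
  suc n * suc n                        ∎
  where
  open ≡-Reasoning
  step : ∀ s → 2 * (s + (n + 0)) + suc n ≡ (2 * s + n) + (2 * n + 1)
  step s = solve (s ∷ n ∷ [])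

sum-upTo-even : ∀ n → sum (upTo (2 * n)) + n ≡ 2 * (n * n)
sum-upTo-even n = *-cancelˡ-≡ _ _ 2 (begin
  2 * (sum (upTo (2 * n)) + n)     ≡⟨ *-distribˡ-+ 2 (sum (upTo (2 * n))) n ⟩
  2 * sum (upTo (2 * n)) + 2 * n   ≡⟨ sum-upTo (2 * n) ⟩
  2 * n * (2 * n)                  ≡⟨ solve (n ∷ []) ⟩
  2 * (2 * (n * n))                ∎)
  where open ≡-Reasoning

matching-length-parity : ∀ n {F} → IsPerfectMatching n F → 2 ∣ sum (lengths (2 * n) F) + n
matching-length-parity n {F} (edges , covers) =
  ∣m+n∣m⇒∣n (subst (2 ∣_) (regroup L U) (∣m∣n⇒∣m+n L+U-even U+n-even)) (divides U (*-comm 2 U))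
  where
  L = sum (lengths (2 * n) F)
  U = sum (upTo (2 * n))
  regroup : ∀ L U → (L + U) + (U + n) ≡ 2 * U + (L + n)
  regroup L U = solve (L ∷ U ∷ n ∷ [])
  L+U-even : 2 ∣ L + U
  L+U-even = subst (λ E → 2 ∣ L + E) (sum-↭ covers) (lengths+endpoints-even (divides n (*-comm 2 n)) edges)
  U+n-even : 2 ∣ U + n
  U+n-even = divides (n * n) (trans (sum-upTo-even n) (*-comm 2 (n * n)))

odd-not-even : ∀ x → ¬ 2 ∣ 1 + 2 * x
odd-not-even x 2∣odd
  with ∣1⇒≡1 (∣m+n∣m⇒∣n (subst (2 ∣_) (+-comm 1 (2 * x)) 2∣odd) (divides x (*-comm 2 x)))
... | ()

not-even-by-double : ∀ {a b} x → 2 * a + b ≡ 2 * (1 + 2 * x) + b → ¬ 2 ∣ a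
not-even-by-double {a} {b} x eq = odd-not-even x ∘ subst (2 ∣_) (*-cancelˡ-≡ _ _ 2 (+-cancelʳ-≡ b _ _ eq))

triangular+m-double : ∀ m → 2 * (triangular m + m) + suc m ≡ suc m * suc m + 2 * m
triangular+m-double m = begin
  2 * (T + m) + suc m    ≡⟨ regroup T ⟩
  (2 * T + suc m) + 2 * m ≡⟨ cong (_+ 2 * m) (sum-upTo (suc m)) ⟩
  suc m * suc m + 2 * m  ∎
  where
  open ≡-Reasoning
  T = triangular m
  regroup : ∀ T → 2 * (T + m) + suc m ≡ (2 * T + suc m) + 2 * m
  regroup T = solve (T ∷ m ∷ [])

-- triangular m + m = m(m + 3)/2 is (2q + 1)(4q + 5) for m = 4q + 2 and (4q + 3)(2q + 3) for m = 4q + 3.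
triangular+m-odd₂ : ∀ q → ¬ 2 ∣ triangular (2 + q * 4) + (2 + q * 4)
triangular+m-odd₂ q = not-even-by-double {b = 3 + q * 4} (2 + 7 * q + 4 * (q * q))
  (trans (triangular+m-double (2 + q * 4)) (solve (q ∷ [])))

triangular+m-odd₃ : ∀ q → ¬ 2 ∣ triangular (3 + q * 4) + (3 + q * 4)
triangular+m-odd₃ q = not-even-by-double {b = 4 + q * 4} (4 + 9 * q + 4 * (q * q))
  (trans (triangular+m-double (3 + q * 4)) (solve (q ∷ [])))

even-triangular+m⇒mod4 : ∀ m → 2 ∣ triangular m + m → m % 4 ≡ 0 ⊎ m % 4 ≡ 1
even-triangular+m⇒mod4 m even with m % 4 | m%n<n m 4 | m≡m%n+[m/n]*n m 4
... | 0 | _ | _ = inj₁ refl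
... | 1 | _ | _ = inj₂ refl
... | 2 | _ | m≡ = ⊥-elim (triangular+m-odd₂ (m / 4) (subst (λ k → 2 ∣ triangular k + k) m≡ even))
... | 3 | _ | m≡ = ⊥-elim (triangular+m-odd₃ (m / 4) (subst (λ k → 2 ∣ triangular k + k) m≡ even))
... | suc (suc (suc (suc _))) | s≤s (s≤s (s≤s (s≤s ()))) | _

t*[triangular+m]-even : ∀ m t {F} → IsPerfectMatching (m * t) F →
                          lengths (2 * (m * t)) F ↭ repeatedRange t m → 2 ∣ t * (triangular m + m)
t*[triangular+m]-even m t {F} matching lengths↭ = subst (2 ∣_) total (matching-length-parity (m * t) matching)
  where
  factor : ∀ T → t * T + m * t ≡ t * (T + m)
  factor T = solve (t ∷ T ∷ m ∷ [])
  total : sum (lengths (2 * (m * t)) F) + m * t ≡ t * (triangular m + m)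
  total = trans (cong (_+ m * t) (trans (sum-↭ lengths↭) (sum-repeatedRange t m))) (factor (triangular m))

condition-of-matching : ∀ m t {F} → IsPerfectMatching (m * t) F →
                        lengths (2 * (m * t)) F ↭ repeatedRange t m → 2 ∣ t ⊎ (m % 4 ≡ 0 ⊎ m % 4 ≡ 1)
condition-of-matching m t matching lengths↭ =
  map₂ (even-triangular+m⇒mod4 m) (euclidsLemma t _ prime[2] (t*[triangular+m]-even m t matching lengths↭))

-- Packings of an interval

-- The holes H are the vertices of [a, a + L) left uncovered; close pairs up two of them.
record Packing (a L : ℕ) (H D : List ℕ) : Set where
  field
    edges  : List Edge
    covers : endpoints edges ++ H ↭ interval a L
    gaps   : map gap edges ↭ D

open Packing

emptyPacking : ∀ {a} → Packing a 0 [] []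
emptyPacking = record { edges = [] ; covers = ↭-refl ; gaps = ↭-refl }

hole : ∀ {a} → Packing a 1 [ a ] []
hole = record { edges = [] ; covers = ↭-refl ; gaps = ↭-refl }

join : ∀ {a b L L' H H' D D'} → b ≡ a + L → Packing a L H D → Packing b L' H' D' →
       Packing a (L + L') (H ++ H') (D ++ D')
join {a} {L = L} {L'} {H} {H'} refl P Q = record
  { edges  = edges P ++ edges Q
  ; covers = begin
      endpoints (edges P ++ edges Q) ++ H ++ H'
        ≡⟨ cong (_++ H ++ H') (endpoints-++ (edges P) (edges Q)) ⟩
      (endpoints (edges P) ++ endpoints (edges Q)) ++ H ++ H'
        ↭⟨ solve-↭ 4 (λ p q h h' → (p ⊕ q) ⊕ (h ⊕ h') ⊜ (p ⊕ h) ⊕ (q ⊕ h')) ↭-refl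
             (endpoints (edges P)) (endpoints (edges Q)) H H' ⟩
      (endpoints (edges P) ++ H) ++ (endpoints (edges Q) ++ H')
        ↭⟨ ++⁺ (covers P) (covers Q) ⟩
      interval a L ++ interval (a + L) L'
        ≡⟨ interval-++ a L L' ⟨
      interval a (L + L') ∎
  ; gaps   = ↭-trans (↭-reflexive (map-++ gap (edges P) (edges Q))) (++⁺ (gaps P) (gaps Q))
  }
  where open PermutationReasoning

close : ∀ {a L x y d H H' D} → Packing a L H D → H ↭ x ∷ y ∷ H' → y ≡ x + d → Packing a L H' (d ∷ D)
close {a} {L} {x} {y} {d} {H} {H'} P H↭ refl = record
  { edges  = (x , x + d) ∷ edges P
  ; covers = begin
      x ∷ x + d ∷ endpoints (edges P) ++ H'
        ↭⟨ solve-↭ 3 (λ xy e h → xy ⊕ (e ⊕ h) ⊜ e ⊕ (xy ⊕ h)) ↭-refl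
             (x ∷ x + d ∷ []) (endpoints (edges P)) H' ⟩
      endpoints (edges P) ++ x ∷ x + d ∷ H' ↭⟨ ++⁺ˡ (endpoints (edges P)) (↭-sym H↭) ⟩
      endpoints (edges P) ++ H              ↭⟨ covers P ⟩
      interval a L                          ∎
  ; gaps   = ↭-trans (↭-reflexive (cong (_∷ map gap (edges P)) (absDiff-+ x d))) (↭-prep d (gaps P))
  }
  where open PermutationReasoning

reshape : ∀ {a L L' H H' D D'} → Packing a L H D → L ≡ L' → H ↭ H' → D ↭ D' → Packing a L' H' D'
reshape P refl H↭ D↭ = record
  { edges  = edges P
  ; covers = ↭-trans (++⁺ˡ (endpoints (edges P)) (↭-sym H↭)) (covers P)
  ; gaps   = ↭-trans (gaps P) D↭
  }

bracket : ∀ {a L H D} → Packing (suc a) L H D → Packing a (2 + L) H (suc L ∷ D)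
bracket {a} {L} {H} {D} P =
  reshape (close (join (+-comm 1 a) hole (join refl P hole))
                 (↭-prep a (++-comm H [ suc a + L ])) (sym (+-suc a L)))
    (cong suc (+-comm L 1)) ↭-refl (↭-prep (suc L) (↭-reflexive (++-identityʳ D)))

nestedGaps : ℕ → ℕ → List ℕ
nestedGaps L zero = []
nestedGaps L (suc k) = suc L ∷ nestedGaps (2 + L) k

nest : ∀ k {a L H D} → Packing (k + a) L H D → Packing a (L + 2 * k) H (nestedGaps L k ++ D)
nest zero {L = L} P = reshape P (sym (+-identityʳ L)) ↭-refl ↭-refl
nest (suc k) {L = L} {D = D} P =
  reshape (nest k (bracket P)) (solve (k ∷ L ∷ [])) ↭-refl (shift (suc L) (nestedGaps (2 + L) k) D)

twinBracket : ∀ {a L H D} → Packing (2 + a) L H D → Packing a (4 + L) H (2 + L ∷ 2 + L ∷ D)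
twinBracket {a} {L} {H} {D} P =
  reshape (close {d = 2 + L} (close {d = 2 + L} (join (+-comm 2 a) (join refl hole hole)
                                                       (join refl P (join refl hole hole)))
                                     holes (solve (a ∷ L ∷ [])))
                 ↭-refl (solve (a ∷ L ∷ [])))
    (solve (L ∷ [])) ↭-refl (↭-prep _ (↭-prep _ (↭-reflexive (++-identityʳ D))))
  where
  holes : a ∷ a + 1 ∷ (H ++ 2 + a + L ∷ 2 + a + L + 1 ∷ []) ↭
          a ∷ 2 + a + L ∷ a + 1 ∷ 2 + a + L + 1 ∷ H
  holes = solve-↭ 5 (λ p p' h q q' → p ⊕ (p' ⊕ (h ⊕ (q ⊕ q'))) ⊜ p ⊕ (q ⊕ (p' ⊕ (q' ⊕ h))))
            ↭-refl
            [ a ] [ a + 1 ] H [ 2 + a + L ] [ 2 + a + L + 1 ]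

nestedGaps-++ : ∀ L k l → nestedGaps L (k + l) ≡ nestedGaps L k ++ nestedGaps (L + 2 * k) l
nestedGaps-++ L zero l = cong (λ L' → nestedGaps L' l) (sym (+-identityʳ L))
nestedGaps-++ L (suc k) l = cong (suc L ∷_) (trans (nestedGaps-++ (2 + L) k l)
  (cong (λ L' → nestedGaps (2 + L) k ++ nestedGaps L' l) (solve (L ∷ k ∷ []))))

nestedGaps-snoc : ∀ L k → nestedGaps L (suc k) ≡ nestedGaps L k ++ [ suc (L + 2 * k) ]
nestedGaps-snoc L k = trans (cong (nestedGaps L) (+-comm 1 k)) (nestedGaps-++ L k 1)

interval-parity-split : ∀ L j → interval (suc L) (2 * j) ↭ nestedGaps L j ++ nestedGaps (suc L) j
interval-parity-split L zero = ↭-refl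
interval-parity-split L (suc j) = begin
  interval (suc L) (2 * suc j)
    ≡⟨ cong (interval (suc L)) (solve (j ∷ [])) ⟩
  suc L ∷ 2 + L ∷ interval (3 + L) (2 * j)
    ↭⟨ ↭-prep (suc L) (↭-prep (2 + L) (interval-parity-split (2 + L) j)) ⟩
  suc L ∷ 2 + L ∷ nestedGaps (2 + L) j ++ nestedGaps (3 + L) j
    ↭⟨ ↭-prep (suc L) (↭-sym (shift (2 + L) (nestedGaps (2 + L) j) (nestedGaps (3 + L) j))) ⟩
  suc L ∷ nestedGaps (2 + L) j ++ 2 + L ∷ nestedGaps (3 + L) j ∎
  where open PermutationReasoning

interval-parity-split-odd : ∀ L j → interval (suc L) (suc (2 * j)) ↭ nestedGaps L (suc j) ++ nestedGaps (suc L) j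
interval-parity-split-odd L j = ↭-prep (suc L) (↭-trans (interval-parity-split (suc L) j)
  (++-comm (nestedGaps (suc L) j) (nestedGaps (2 + L) j)))

-- Skolem systems

FoldSkolem : ℕ → ℕ → Set
FoldSkolem c m = ∀ {a} → Packing a (2 * (m * c)) [] (repeatedRange c m)

foldSkolem-0 : ∀ m → FoldSkolem 0 m
foldSkolem-0 m =
  reshape emptyPacking (cong (2 *_) (sym (*-zeroʳ m))) ↭-refl (↭-reflexive (sym (repeatedRange-0 m)))

foldSkolem-+ : ∀ {c c' m} → FoldSkolem c m → FoldSkolem c' m → FoldSkolem (c + c') m
foldSkolem-+ {c} {c'} {m} S S' =
  reshape (join refl S S') (solve (m ∷ c ∷ c' ∷ [])) ↭-refl (↭-sym (repeatedRange-+ c c' m))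

foldSkolem-* : ∀ k {c m} → FoldSkolem c m → FoldSkolem (k * c) m
foldSkolem-* zero {m = m} S = foldSkolem-0 m
foldSkolem-* (suc k) {c} {m} S = foldSkolem-+ {c} {k * c} {m} S (foldSkolem-* k {c} {m} S)

evensTwice : ∀ j {a} → Packing a (2 + 4 * j) [] (1 + 2 * j ∷ nestedGaps 1 j ++ nestedGaps 1 j)
evensTwice j {a} =
  reshape (close {d = 1 + 2 * j} (join refl (nest j hole) (nest j hole)) ↭-refl (solve (a ∷ j ∷ [])))
    (solve (j ∷ [])) ↭-refl
    (↭-prep _ (↭-reflexive (cong₂ _++_ (++-identityʳ (nestedGaps 1 j)) (++-identityʳ (nestedGaps 1 j)))))

twofold-odd : ∀ j → FoldSkolem 2 (suc (2 * j))
twofold-odd j =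
  reshape (join refl (evensTwice j) (join refl (nest j emptyPacking) (nest (suc j) emptyPacking)))
    (solve (j ∷ [])) ↭-refl all-gaps
  where
  top = suc (2 * j)
  od = nestedGaps 0 j
  ev = nestedGaps 1 j
  all-gaps : (top ∷ ev ++ ev) ++ (od ++ []) ++ (nestedGaps 0 (suc j) ++ []) ↭ repeatedRange 2 top
  all-gaps = begin
    (top ∷ ev ++ ev) ++ (od ++ []) ++ (nestedGaps 0 (suc j) ++ [])
      ≡⟨ cong (λ G → (top ∷ ev ++ ev) ++ (od ++ []) ++ (G ++ [])) (nestedGaps-snoc 0 j) ⟩
    (top ∷ ev ++ ev) ++ (od ++ []) ++ ((od ++ [ top ]) ++ [])
      ↭⟨ solve-↭ 3 (λ t o e → (t ⊕ (e ⊕ e)) ⊕ ((o ⊕ id) ⊕ ((o ⊕ t) ⊕ id))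
                              ⊜ ((o ⊕ t) ⊕ e) ⊕ ((o ⊕ t) ⊕ e))
           ↭-refl [ top ] od ev ⟩
    ((od ++ [ top ]) ++ ev) ++ ((od ++ [ top ]) ++ ev)
      ≡⟨ cong (λ G → (G ++ ev) ++ (G ++ ev)) (nestedGaps-snoc 0 j) ⟨
    (nestedGaps 0 (suc j) ++ ev) ++ (nestedGaps 0 (suc j) ++ ev)
      ↭⟨ ++⁺ (interval-parity-split-odd 0 j) (interval-parity-split-odd 0 j) ⟨
    interval 1 top ++ interval 1 top
      ↭⟨ repeatedRange-2 top ⟨
    repeatedRange 2 top ∎
    where open PermutationReasoning

twofold-even : ∀ j → FoldSkolem 2 (2 * j)
twofold-even zero = emptyPacking
twofold-even (suc j) =
  reshape (join refl (evensTwice j) (join refl (twinBracket (nest j emptyPacking)) (nest (suc j) emptyPacking)))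
    (solve (j ∷ [])) ↭-refl all-gaps
  where
  top = suc (2 * j)
  e = 2 + 2 * j
  od = nestedGaps 0 j
  ev = nestedGaps 1 j
  all-gaps : (top ∷ ev ++ ev) ++ (e ∷ e ∷ od ++ []) ++ (nestedGaps 0 (suc j) ++ []) ↭ repeatedRange 2 (2 * suc j)
  all-gaps = begin
    (top ∷ ev ++ ev) ++ (e ∷ e ∷ od ++ []) ++ (nestedGaps 0 (suc j) ++ [])
      ≡⟨ cong (λ G → (top ∷ ev ++ ev) ++ (e ∷ e ∷ od ++ []) ++ (G ++ [])) (nestedGaps-snoc 0 j) ⟩
    (top ∷ ev ++ ev) ++ (e ∷ e ∷ od ++ []) ++ ((od ++ [ top ]) ++ [])
      ↭⟨ solve-↭ 4 (λ t e o v → (t ⊕ (v ⊕ v)) ⊕ ((e ⊕ (e ⊕ (o ⊕ id))) ⊕ ((o ⊕ t) ⊕ id))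
                              ⊜ ((o ⊕ t) ⊕ (v ⊕ e)) ⊕ ((o ⊕ t) ⊕ (v ⊕ e)))
           ↭-refl [ top ] [ e ] od ev ⟩
    ((od ++ [ top ]) ++ ev ++ [ e ]) ++ ((od ++ [ top ]) ++ ev ++ [ e ])
      ≡⟨ cong₂ (λ G G' → (G ++ G') ++ (G ++ G')) (nestedGaps-snoc 0 j) (nestedGaps-snoc 1 j) ⟨
    (nestedGaps 0 (suc j) ++ nestedGaps 1 (suc j)) ++ (nestedGaps 0 (suc j) ++ nestedGaps 1 (suc j))
      ↭⟨ ++⁺ (interval-parity-split 0 (suc j)) (interval-parity-split 0 (suc j)) ⟨
    interval 1 (2 * suc j) ++ interval 1 (2 * suc j)
      ↭⟨ repeatedRange-2 (2 * suc j) ⟨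
    repeatedRange 2 (2 * suc j) ∎
    where open PermutationReasoning

twofold : ∀ m → FoldSkolem 2 m
twofold m with m % 2 | m%n<n m 2 | m≡m%n+[m/n]*n m 2
... | 0 | _ | m≡ = subst (FoldSkolem 2) (sym (trans m≡ (*-comm (m / 2) 2))) (twofold-even (m / 2))
... | 1 | _ | m≡ = subst (FoldSkolem 2) (sym (trans m≡ (cong suc (*-comm (m / 2) 2)))) (twofold-odd (m / 2))
... | suc (suc _) | s≤s (s≤s ()) | _

skolemFrameGaps : ℕ → ℕ → List ℕ
skolemFrameGaps u k = 1 ∷ nestedGaps 2 u ++ nestedGaps (4 + 2 * u) k ++ nestedGaps 1 (4 + 2 * u)

-- Holes p, p + 1 inside k nested pairs, a hole q, and a hole r inside 4 + 2u nested pairs;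
-- the Skolem systems of order 4u + 8 and 4u + 9 close these holes in two ways.
skolemFrame : ∀ u k {a} → Packing a (2 * k + 6 * u + 14)
  (a + k + u + 2 ∷ a + k + u + 3 ∷ a + 2 * k + 2 * u + 4 ∷ a + 2 * k + 4 * u + 9 ∷ [])
  (skolemFrameGaps u k)
skolemFrame u k {a} =
  reshape (join refl (nest k core) (join refl hole (nest (4 + 2 * u) hole)))
    (solve (u ∷ k ∷ []))
    (↭-reflexive (cong₂ _∷_ (solve (a ∷ u ∷ k ∷ [])) (cong₂ _∷_ (solve (a ∷ u ∷ k ∷ []))
       (cong₂ _∷_ (solve (a ∷ u ∷ k ∷ [])) (cong₂ _∷_ (solve (a ∷ u ∷ k ∷ [])) refl)))))
    (solve-↭ 4 (λ o i i' e → (i' ⊕ (o ⊕ i)) ⊕ (e ⊕ id) ⊜ o ⊕ (i ⊕ (i' ⊕ e))) ↭-refl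
       [ 1 ] (nestedGaps 2 u) (nestedGaps (4 + 2 * u) k) (nestedGaps 1 (4 + 2 * u)))
  where
  core : ∀ {b} → Packing b (4 + 2 * u) (b + u + 2 ∷ b + u + 3 ∷ []) (1 ∷ nestedGaps 2 u)
  core {b} = reshape (join refl (bracket emptyPacking) (nest u (join refl hole hole)))
    (solve (u ∷ []))
    (↭-reflexive (cong₂ _∷_ (solve (b ∷ u ∷ [])) (cong₂ _∷_ (solve (b ∷ u ∷ [])) refl)))
    (↭-prep 1 (↭-reflexive (++-identityʳ (nestedGaps 2 u))))

skolemFrame-gaps : ∀ u k → 5 + 2 * u + 2 * k ∷ 3 + 2 * u ∷ skolemFrameGaps u k ↭
                   nestedGaps 0 (suc (u + suc (k + 1))) ++ nestedGaps 1 (4 + 2 * u)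
skolemFrame-gaps u k = begin
  top ∷ mid ∷ 1 ∷ inner ++ outer ++ evens
    ↭⟨ solve-↭ 6 (λ t m o i u e → t ⊕ (m ⊕ (o ⊕ (i ⊕ (u ⊕ e))))
                                  ⊜ (o ⊕ (i ⊕ (m ⊕ (u ⊕ t)))) ⊕ e)
         ↭-refl [ top ] [ mid ] [ 1 ] inner outer evens ⟩
  (1 ∷ inner ++ mid ∷ outer ++ [ top ]) ++ evens
    ≡⟨ cong (λ G → (1 ∷ G) ++ evens) odds ⟨
  nestedGaps 0 (suc (u + suc (k + 1))) ++ evens ∎
  where
  open PermutationReasoning
  top = 5 + 2 * u + 2 * k
  mid = 3 + 2 * u
  inner = nestedGaps 2 u
  outer = nestedGaps (4 + 2 * u) k
  evens = nestedGaps 1 (4 + 2 * u)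
  odds : nestedGaps 2 (u + suc (k + 1)) ≡ inner ++ mid ∷ outer ++ [ top ]
  odds = trans (nestedGaps-++ 2 u (suc (k + 1))) (cong (λ G → inner ++ mid ∷ G) (nestedGaps-++ (4 + 2 * u) k 1))

skolem-8+4u : ∀ u → FoldSkolem 1 (suc (suc u) * 4)
skolem-8+4u u {a} =
  reshape (close {d = 7 + 4 * u} (close {d = 3 + 2 * u} (skolemFrame u (suc u))
                                          (↭-prep _ (↭-swap _ _ ↭-refl)) (solve (a ∷ u ∷ [])))
                 ↭-refl (solve (a ∷ u ∷ [])))
    (solve (u ∷ [])) ↭-refl all-gaps
  where
  top : 7 + 4 * u ≡ 5 + 2 * u + 2 * suc u
  top = solve (u ∷ [])
  count : suc (u + suc (suc u + 1)) ≡ 4 + 2 * u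
  count = solve (u ∷ [])
  length : 2 * (4 + 2 * u) ≡ suc (suc u) * 4
  length = solve (u ∷ [])
  all-gaps : 7 + 4 * u ∷ 3 + 2 * u ∷ skolemFrameGaps u (suc u) ↭ repeatedRange 1 (suc (suc u) * 4)
  all-gaps = begin
    7 + 4 * u ∷ 3 + 2 * u ∷ skolemFrameGaps u (suc u)
      ≡⟨ cong (λ t → t ∷ 3 + 2 * u ∷ skolemFrameGaps u (suc u)) top ⟩
    5 + 2 * u + 2 * suc u ∷ 3 + 2 * u ∷ skolemFrameGaps u (suc u)
      ↭⟨ skolemFrame-gaps u (suc u) ⟩
    nestedGaps 0 (suc (u + suc (suc u + 1))) ++ nestedGaps 1 (4 + 2 * u)
      ≡⟨ cong (λ j → nestedGaps 0 j ++ nestedGaps 1 (4 + 2 * u)) count ⟩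
    nestedGaps 0 (4 + 2 * u) ++ nestedGaps 1 (4 + 2 * u)
      ↭⟨ interval-parity-split 0 (4 + 2 * u) ⟨
    interval 1 (2 * (4 + 2 * u))
      ≡⟨ cong (interval 1) length ⟩
    interval 1 (suc (suc u) * 4)
      ≡⟨ repeatedRange-1 (suc (suc u) * 4) ⟨
    repeatedRange 1 (suc (suc u) * 4) ∎
    where open PermutationReasoning

skolem-9+4u : ∀ u → FoldSkolem 1 (1 + suc (suc u) * 4)
skolem-9+4u u {a} =
  reshape (close {d = 9 + 4 * u} (close {d = 3 + 2 * u} (skolemFrame u (suc (suc u)))
                                          (↭-trans (↭-swap _ _ ↭-refl) (↭-prep _ (↭-swap _ _ ↭-refl)))
                                          (solve (a ∷ u ∷ [])))
                 ↭-refl (solve (a ∷ u ∷ [])))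
    (solve (u ∷ [])) ↭-refl all-gaps
  where
  top : 9 + 4 * u ≡ 5 + 2 * u + 2 * suc (suc u)
  top = solve (u ∷ [])
  count : suc (u + suc (suc (suc u) + 1)) ≡ 5 + 2 * u
  count = solve (u ∷ [])
  length : suc (2 * (4 + 2 * u)) ≡ 1 + suc (suc u) * 4
  length = solve (u ∷ [])
  all-gaps : 9 + 4 * u ∷ 3 + 2 * u ∷ skolemFrameGaps u (suc (suc u)) ↭ repeatedRange 1 (1 + suc (suc u) * 4)
  all-gaps = begin
    9 + 4 * u ∷ 3 + 2 * u ∷ skolemFrameGaps u (suc (suc u))
      ≡⟨ cong (λ t → t ∷ 3 + 2 * u ∷ skolemFrameGaps u (suc (suc u))) top ⟩
    5 + 2 * u + 2 * suc (suc u) ∷ 3 + 2 * u ∷ skolemFrameGaps u (suc (suc u))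
      ↭⟨ skolemFrame-gaps u (suc (suc u)) ⟩
    nestedGaps 0 (suc (u + suc (suc (suc u) + 1))) ++ nestedGaps 1 (4 + 2 * u)
      ≡⟨ cong (λ j → nestedGaps 0 j ++ nestedGaps 1 (4 + 2 * u)) count ⟩
    nestedGaps 0 (5 + 2 * u) ++ nestedGaps 1 (4 + 2 * u)
      ↭⟨ interval-parity-split-odd 0 (4 + 2 * u) ⟨
    interval 1 (suc (2 * (4 + 2 * u)))
      ≡⟨ cong (interval 1) length ⟩
    interval 1 (1 + suc (suc u) * 4)
      ≡⟨ repeatedRange-1 (1 + suc (suc u) * 4) ⟨
    repeatedRange 1 (1 + suc (suc u) * 4) ∎
    where open PermutationReasoning

-- 1 1 3 4 2 3 2 4
skolem-4 : FoldSkolem 1 4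
skolem-4 {a} =
  reshape (close {d = 3} (join refl (bracket emptyPacking) (join refl hole (nest 2 hole)))
                 ↭-refl (solve (a ∷ [])))
    refl ↭-refl (↭-sym (shift 3 (1 ∷ 2 ∷ []) (4 ∷ [])))

-- 4 1 1 5 4 2 3 2 5 3
skolem-5 : FoldSkolem 1 5
skolem-5 {a} =
  reshape (close {d = 3} (close {d = 5} (join refl (bracket (join refl (bracket emptyPacking) hole))
                                                    (join refl (bracket hole) (join refl hole hole)))
                                         (↭-prep _ (↭-swap _ _ ↭-refl)) (solve (a ∷ [])))
                 ↭-refl (solve (a ∷ [])))
    refl ↭-refl
    (solve-↭ 5 (λ g₁ g₂ g₃ g₄ g₅ → g₃ ⊕ (g₅ ⊕ (g₄ ⊕ (g₁ ⊕ g₂))) ⊜ g₁ ⊕ (g₂ ⊕ (g₃ ⊕ (g₄ ⊕ g₅))))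
       ↭-refl
       [ 1 ] [ 2 ] [ 3 ] [ 4 ] [ 5 ])

skolem-4q : ∀ q → FoldSkolem 1 (q * 4)
skolem-4q zero = emptyPacking
skolem-4q (suc zero) = skolem-4
skolem-4q (suc (suc u)) = skolem-8+4u u

skolem-4q+1 : ∀ q → FoldSkolem 1 (1 + q * 4)
skolem-4q+1 zero = bracket emptyPacking
skolem-4q+1 (suc zero) = skolem-5
skolem-4q+1 (suc (suc u)) = skolem-9+4u u

skolem : ∀ m → m % 4 ≡ 0 ⊎ m % 4 ≡ 1 → FoldSkolem 1 m
skolem m residue = subst (FoldSkolem 1) (sym (m≡m%n+[m/n]*n m 4)) (by-residue residue)
  where
  by-residue : m % 4 ≡ 0 ⊎ m % 4 ≡ 1 → FoldSkolem 1 (m % 4 + m / 4 * 4)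
  by-residue (inj₁ r≡0) rewrite r≡0 = skolem-4q (m / 4)
  by-residue (inj₂ r≡1) rewrite r≡1 = skolem-4q+1 (m / 4)

foldSkolem-of-condition : ∀ t m → 2 ∣ t ⊎ (m % 4 ≡ 0 ⊎ m % 4 ≡ 1) → FoldSkolem t m
foldSkolem-of-condition t m (inj₁ (divides k refl)) = foldSkolem-* k {2} {m} (twofold m)
foldSkolem-of-condition t m (inj₂ residue) =
  subst (λ c → FoldSkolem c m) (*-identityʳ t) (foldSkolem-* t {1} {m} (skolem m residue))

-- Sufficiency

edgeLength-short : ∀ N e → gap e + gap e ≤ N → edgeLength N e ≡ gap e
edgeLength-short N e short = m≤n⇒m⊓n≡m (m+n≤o⇒m≤o∸n (gap e) short)

endpoints-bounded : ∀ {N} F → All (_< N) (endpoints F) → All (λ e → proj₁ e < N × proj₂ e < N) F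
endpoints-bounded [] _ = All.[]
endpoints-bounded ((u , w) ∷ F) (u<N All.∷ w<N All.∷ rest) =
  (u<N , w<N) All.∷ endpoints-bounded F rest

positive-gap⇒edge : ∀ {N u w} → u < N → w < N → 1 ≤ gap (u , w) → IsEdgeOf N (u , w)
positive-gap⇒edge {u = u} u<N w<N 1≤gap =
  u<N , w<N , λ { refl → <-irrefl (sym (cong₂ _+_ (n∸n≡0 u) (n∸n≡0 u))) 1≤gap }

matching-of-foldSkolem : ∀ t m .{{_ : NonZero t}} → FoldSkolem t m →
  Σ (List Edge) (λ F → IsPerfectMatching (m * t) F × (lengths (2 * (m * t)) F ↭ repeatedRange t m))
matching-of-foldSkolem t m S = F , (edges-ok , endpoints-ok) , lengths-ok
  where
  N = 2 * (m * t)
  P = S {0}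
  F = edges P
  endpoints-ok : endpoints F ↭ upTo N
  endpoints-ok = begin
    endpoints F        ≡⟨ ++-identityʳ (endpoints F) ⟨
    endpoints F ++ []  ↭⟨ covers P ⟩
    interval 0 N       ≡⟨ applyUpTo-interval (λ i → i) 0 N (λ _ → refl) ⟨
    upTo N             ∎
    where open PermutationReasoning
  gap-bounds : All (λ e → 1 ≤ gap e × gap e ≤ m) F
  gap-bounds = map⁻ (All-resp-↭ (↭-sym (gaps P)) (repeatedRange-bounds t m))
  ends-bounded : All (λ e → proj₁ e < N × proj₂ e < N) F
  ends-bounded =
    endpoints-bounded F (All-resp-↭ (↭-sym endpoints-ok) (applyUpTo⁺₁ (λ i → i) N (λ i<N → i<N)))
  edges-ok : All (IsEdgeOf N) F
  edges-ok = All.zipWith (λ ((u<N , w<N) , (1≤gap , _)) → positive-gap⇒edge u<N w<N 1≤gap)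
                         (ends-bounded , gap-bounds)
  short : ∀ {d} → d ≤ m → d + d ≤ N
  short {d} d≤m = subst (d + d ≤_) (double (m * t)) (+-mono-≤ d≤mt d≤mt)
    where
    d≤mt = ≤-trans d≤m (m≤m*n m t)
    double : ∀ x → x + x ≡ 2 * x
    double x = solve (x ∷ [])
  lengths-ok : lengths N F ↭ repeatedRange t m
  lengths-ok = ↭-trans
    (↭-reflexive (map-cong-local (All.map (λ {e} (_ , d≤m) → edgeLength-short N e (short d≤m)) gap-bounds)))
    (gaps P)

corollary4p9 : (n t : ℕ) → 0 < n → .{{_ : NonZero t}} → t ∣ n →
    (Σ (List Edge) (λ F → IsPerfectMatching n F × (lengths (2 * n) F ↭ repeatedRange t (n / t))))
      ⇔ (2 ∣ t ⊎ ((n / t) % 4 ≡ 0 ⊎ (n / t) % 4 ≡ 1))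
corollary4p9 n t _ ⦃ t≢0 ⦄ (divides m refl) rewrite m*n/n≡m m t ⦃ t≢0 ⦄ =
  mk⇔ (λ (F , matching , lengths↭) → condition-of-matching m t matching lengths↭)
      (matching-of-foldSkolem t m ∘ foldSkolem-of-condition t m)
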